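{- Let $[(s_0),\ \{(k)\leadsto (e_1(k))\cdots(e_k(k))\}]$ be an ECO-system, let $b$ be a nonnegative integer, and for $k\ge1$ let $m(k)=|\{i\le k:\ e_i(k)\ge k-b\}|$. Assume that 1. for every $k$ there is a forward jump from $k$, i.e. $e_i(k)>k$ for some $i$; and 2. the sequence $(m(k))_k$ is nondecreasing and tends to infinity. Then the ordinary generating function $F(z)=\sum_{n\ge0}f_nz^n$ of the system has radius of convergence $0$.
   Context: An ECO-system $[(s_0),\ \{(k)\leadsto (e_1(k))\cdots(e_k(k))\}]$ consists of a positive integer axiom $s_0$ and, for each positive integer label $k$, a list of $k$ positive integers $e_1(k),\dots,e_k(k)$. Its generating tree is the rooted plane tree whose root is labeled $s_0$ and in which every node labeled $k$ has exactly $k$ children, labeled $e_1(k),\dots,e_k(k)$. The root is at level $0$; $f_n$ denotes the number of nodes at level $n$ (so $f_0=1$), and $F(z)=\sum_{n\ge0} f_n z^n$. -}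

module Defs where

open import Data.Nat using (ℕ; zero; suc; _≤_; _<_; _∸_; _≤?_)
open import Data.Fin using (Fin)
open import Data.List using (List; []; _∷_; concatMap; length; filter; allFin)
open import Data.Vec.Functional using (toList)
open import Data.Product using (Σ; ∃; _×_)

-- An ECO-system: a positive axiom s₀ and, for every label k, a list of k
-- positive labels e k 0, …, e k (k-1)  (i.e. e_1(k), …, e_k(k)).
record ECO : Set where
  field
    s₀     : ℕ
    s₀-pos : 1 ≤ s₀
    e      : (k : ℕ) → Fin k → ℕ
    e-pos  : ∀ k (i : Fin k) → 1 ≤ e k i

module _ (S : ECO) where
  open ECO S

  children : ℕ → List ℕ
  children k = toList (e k)

  level : ℕ → List ℕ
  level zero    = s₀ ∷ []
  level (suc n) = concatMap children (level n)

  f : ℕ → ℕ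
  f n = length (level n)

  m : ℕ → ℕ → ℕ
  m b k = length (filter (λ i → k ∸ b ≤? e k i) (allFin k))

{-# OPTIONS --safe #-}
module Submission where

-- Let C = 2 M^(b+1) and m(k) ≥ C for k ≥ K.  Forward jumps put a node with
-- label > n on every level n.  A node labelled k ≥ T + b has at least m(k)
-- children labelled ≥ k - b ≥ T, so t generations below a node of level and
-- label > K + t b there are at least C^t nodes.  Hence f(t + K + t b) ≥ C^t,
-- which beats B M^(t + K + t b) = B M^K (M^(b+1))^t as soon as 2^t > B M^K.

open import Defs
open import Data.Nat using (ℕ; zero; suc; _+_; _≤_; _<_; _*_; _^_; _∸_; _≤?_; s≤s; z<s; NonZero; >-nonZero)
open import Data.Nat.Properties
open import Data.Fin using (Fin)
open import Data.Product using (∃; _,_)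
open import Data.List using (List; []; _∷_; _++_; length; filter; map; concatMap; allFin)
open import Data.List.Properties using (length-++; filter-++; map-tabulate; length-filter)
open import Data.List.Membership.Propositional.Properties using (∈-filter⁺; ∈-tabulate⁺; ∈-length)
open import Data.List.Relation.Unary.Any using (here)
open import Relation.Nullary using (yes; no; contradiction)
open import Relation.Unary using (Pred; Decidable)
open import Relation.Binary.PropositionalEquality
open import Algebra.Properties.CommutativeSemigroup *-commutativeSemigroup using (interchange; x∙yz≈y∙xz)

module _ {a b p q} {A : Set a} {B : Set b} {P : Pred A p} {Q : Pred B q}
         (P? : Decidable P) (Q? : Decidable Q) where

  length-filter-map-≥ : (g : A → B) → (∀ {x} → P x → Q (g x)) →
    ∀ xs → length (filter P? xs) ≤ length (filter Q? (map g xs))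
  length-filter-map-≥ g P⇒Q [] = ≤-refl
  length-filter-map-≥ g P⇒Q (x ∷ xs) with P? x | Q? (g x)
  ... | yes _  | yes _  = s≤s (length-filter-map-≥ g P⇒Q xs)
  ... | yes px | no ¬qx = contradiction (P⇒Q px) ¬qx
  ... | no _   | yes _  = m≤n⇒m≤1+n (length-filter-map-≥ g P⇒Q xs)
  ... | no _   | no _   = length-filter-map-≥ g P⇒Q xs

  length-filter-++ : ∀ xs ys →
    length (filter Q? (xs ++ ys)) ≡ length (filter Q? xs) + length (filter Q? ys)
  length-filter-++ xs ys = trans (cong length (filter-++ Q? xs ys)) (length-++ (filter Q? xs))

  length-filter-concatMap-≥ : (g : A → List B) (c : ℕ) →
    (∀ {x} → P x → c ≤ length (filter Q? (g x))) →
    ∀ xs → c * length (filter P? xs) ≤ length (filter Q? (concatMap g xs))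
  length-filter-concatMap-≥ g c P⇒c≤ [] = ≤-reflexive (*-zeroʳ c)
  length-filter-concatMap-≥ g c P⇒c≤ (x ∷ xs) with P? x
  ... | yes px = begin
    c * suc (length (filter P? xs))                               ≡⟨ *-suc c _ ⟩
    c + c * length (filter P? xs)                                 ≤⟨ +-mono-≤ (P⇒c≤ px) (length-filter-concatMap-≥ g c P⇒c≤ xs) ⟩
    length (filter Q? (g x)) + length (filter Q? (concatMap g xs)) ≡⟨ length-filter-++ (g x) (concatMap g xs) ⟨
    length (filter Q? (concatMap g (x ∷ xs)))                     ∎
    where open ≤-Reasoning
  ... | no _ = begin
    c * length (filter P? xs)                                     ≤⟨ length-filter-concatMap-≥ g c P⇒c≤ xs ⟩
    length (filter Q? (concatMap g xs))                           ≤⟨ m≤n+m _ _ ⟩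
    length (filter Q? (g x)) + length (filter Q? (concatMap g xs)) ≡⟨ length-filter-++ (g x) (concatMap g xs) ⟨
    length (filter Q? (concatMap g (x ∷ xs)))                     ∎
    where open ≤-Reasoning

n<2^n : ∀ n → n < 2 ^ n
n<2^n zero    = z<s
n<2^n (suc n) = ≤-trans (+-mono-≤ (m^n>0 2 n) (n<2^n n))
                        (≤-reflexive (cong (2 ^ n +_) (sym (+-identityʳ (2 ^ n)))))

^-distribʳ-* : ∀ x y n → (x * y) ^ n ≡ x ^ n * y ^ n
^-distribʳ-* x y zero    = refl
^-distribʳ-* x y (suc n) = trans (cong (x * y *_) (^-distribʳ-* x y n)) (interchange x y (x ^ n) (y ^ n))

count≥ : ℕ → List ℕ → ℕ
count≥ T xs = length (filter (T ≤?_) xs)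

module _ (S : ECO) where
  open ECO S

  m≤count≥-children : ∀ b k {T} → T ≤ k ∸ b → m S b k ≤ count≥ T (children S k)
  m≤count≥-children b k {T} T≤k∸b =
    subst (λ xs → m S b k ≤ count≥ T xs) (map-tabulate (λ i → i) (e k))
      (length-filter-map-≥ (λ i → k ∸ b ≤? e k i) (T ≤?_) (e k) (≤-trans T≤k∸b) (allFin k))

  module _ (forward : ∀ k → 1 ≤ k → ∃ λ (i : Fin k) → k < e k i) where

    count≥-suc-children : ∀ {T k} → 1 ≤ T → T ≤ k → 1 ≤ count≥ (suc T) (children S k)
    count≥-suc-children {T} {k} 1≤T T≤k with forward k (≤-trans 1≤T T≤k)
    ... | i , k<eki = ∈-length (∈-filter⁺ (suc T ≤?_) (∈-tabulate⁺ i) (<-≤-trans (s≤s T≤k) k<eki))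

    level-has-label>n : ∀ n → 1 ≤ count≥ (suc n) (level S n)
    level-has-label>n zero    = ∈-length (∈-filter⁺ (1 ≤?_) (here refl) s₀-pos)
    level-has-label>n (suc n) = begin
      1                                                   ≤⟨ level-has-label>n n ⟩
      count≥ (suc n) (level S n)                          ≡⟨ *-identityˡ _ ⟨
      1 * count≥ (suc n) (level S n)                      ≤⟨ length-filter-concatMap-≥ (suc n ≤?_) (suc (suc n) ≤?_)
                                                              (children S) 1 (count≥-suc-children z<s) (level S n) ⟩
      count≥ (suc (suc n)) (level S (suc n))              ∎
      where open ≤-Reasoning

  module _ {b C K : ℕ} (C≤m : ∀ k → K ≤ k → C ≤ m S b k) where

    count≥-next-level : ∀ {T} → K ≤ T → ∀ n →
      C * count≥ (T + b) (level S n) ≤ count≥ T (level S (suc n))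
    count≥-next-level {T} K≤T n =
      length-filter-concatMap-≥ (T + b ≤?_) (T ≤?_) (children S) C C≤children (level S n)
      where
      C≤children : ∀ {k} → T + b ≤ k → C ≤ count≥ T (children S k)
      C≤children {k} T+b≤k = ≤-trans (C≤m k (≤-trans K≤T (≤-trans (m≤m+n T b) T+b≤k)))
                                     (m≤count≥-children b k (m+n≤o⇒m≤o∸n T T+b≤k))

    count≥-amplify : ∀ s {T} → K ≤ T → ∀ n →
      C ^ s * count≥ (T + s * b) (level S n) ≤ count≥ T (level S (s + n))
    count≥-amplify zero    {T} K≤T n rewrite +-identityʳ T = ≤-reflexive (*-identityˡ _)
    count≥-amplify (suc s) {T} K≤T n = begin
      C * C ^ s * count≥ (T + (b + s * b)) (level S n)   ≡⟨ *-assoc C (C ^ s) _ ⟩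
      C * (C ^ s * count≥ (T + (b + s * b)) (level S n)) ≡⟨ cong (λ U → C * (C ^ s * count≥ U (level S n))) (+-assoc T b (s * b)) ⟨
      C * (C ^ s * count≥ (T + b + s * b) (level S n))   ≤⟨ *-monoʳ-≤ C (count≥-amplify s (≤-trans K≤T (m≤m+n T b)) n) ⟩
      C * count≥ (T + b) (level S (s + n))               ≤⟨ count≥-next-level K≤T (s + n) ⟩
      count≥ T (level S (suc s + n))                     ∎
      where open ≤-Reasoning

  C^t≤f : (∀ k → 1 ≤ k → ∃ λ (i : Fin k) → k < e k i) →
    ∀ {b C K} → (∀ k → K ≤ k → C ≤ m S b k) → ∀ t → C ^ t ≤ f S (t + (K + t * b))
  C^t≤f forward {b} {C} {K} C≤m t = begin
    C ^ t                                                 ≡⟨ *-identityʳ _ ⟨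
    C ^ t * 1                                             ≤⟨ *-monoʳ-≤ (C ^ t) (level-has-label>n forward n₀) ⟩
    C ^ t * count≥ (suc K + t * b) (level S n₀)           ≤⟨ count≥-amplify C≤m t (n≤1+n K) n₀ ⟩
    count≥ (suc K) (level S (t + n₀))                     ≤⟨ length-filter (suc K ≤?_) (level S (t + n₀)) ⟩
    f S (t + n₀)                                          ∎
    where
    open ≤-Reasoning
    n₀ = K + t * b

B*M^n<C^t : ∀ B K M b .{{_ : NonZero M}} → let t = B * M ^ K in
  B * M ^ (t + (K + t * b)) < (2 * M ^ suc b) ^ t
B*M^n<C^t B K M b = begin-strict
  B * M ^ (t + (K + t * b))             ≡⟨ cong (B *_) (^-distribˡ-+-* M t (K + t * b)) ⟩
  B * (M ^ t * M ^ (K + t * b))         ≡⟨ cong (λ z → B * (M ^ t * z)) (^-distribˡ-+-* M K (t * b)) ⟩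
  B * (M ^ t * (M ^ K * M ^ (t * b)))   ≡⟨ cong (B *_) (x∙yz≈y∙xz (M ^ t) (M ^ K) _) ⟩
  B * (M ^ K * (M ^ t * M ^ (t * b)))   ≡⟨ *-assoc B (M ^ K) _ ⟨
  t * (M ^ t * M ^ (t * b))             ≡⟨ cong (λ z → t * (M ^ t * z)) M^[t*b]≡[M^b]^t ⟩
  t * (M ^ t * (M ^ b) ^ t)             ≡⟨ cong (t *_) (^-distribʳ-* M (M ^ b) t) ⟨
  t * Y ^ t                             <⟨ *-monoˡ-< (Y ^ t) {{m^n≢0 Y t}} (n<2^n t) ⟩
  2 ^ t * Y ^ t                         ≡⟨ ^-distribʳ-* 2 Y t ⟨
  (2 * Y) ^ t                           ∎
  where
  open ≤-Reasoning
  t = B * M ^ K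
  Y = M ^ suc b
  instance
    Y-nonZero : NonZero Y
    Y-nonZero = m^n≢0 M (suc b)
  M^[t*b]≡[M^b]^t : M ^ (t * b) ≡ (M ^ b) ^ t
  M^[t*b]≡[M^b]^t = trans (cong (M ^_) (*-comm t b)) (sym (^-*-assoc M b t))

proposition6 : (S : ECO) (b : ℕ)
    → (∀ k → 1 ≤ k → ∃ λ (i : Fin k) → k < ECO.e S k i)
    → (∀ k → 1 ≤ k → m S b k ≤ m S b (suc k))
    → (∀ B → ∃ λ K → ∀ k → K ≤ k → B ≤ m S b k)
    → ∀ (M B : ℕ) → 1 ≤ M → ∃ λ n → B * M ^ n < f S n
proposition6 S b forward _ m→∞ M B 1≤M with m→∞ (2 * M ^ suc b)
... | K , C≤m = t + (K + t * b) ,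
  <-≤-trans (B*M^n<C^t B K M b {{>-nonZero 1≤M}}) (C^t≤f S forward C≤m t)
  where t = B * M ^ K
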